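{- Let $\vdash$ be a finitary abstract consequence relation on a set $A$ with infinitely many theorems, and for $X,Y\subseteq A$ let $X\vdash'Y$ iff $X\vdash a$ for all $a\in Y$. Define $X\Vdash Y$ iff there is a finite $Y'\subseteq Y$ with $Y\setminus Y'\subseteq X$ and $X\vdash'Y'$. Then $\Vdash$ is a deductive relation on $\langle\wp(A),\subseteq,\cup,\emptyset\rangle$ but it is not a GTCR on the complete lattice $\wp(A)$.
   Context: An abstract consequence relation (ACR) on $A$ is ${\vdash}\subseteq\wp(A)\times A$ with: $X\vdash a$ whenever $a\in X$; $X\vdash a$ and $X\subseteq Y$ imply $Y\vdash a$; if $Y\vdash a$ and $X\vdash b$ for all $b\in Y$ then $X\vdash a$. It is finitary if $X\vdash a$ implies $X_0\vdash a$ for some finite $X_0\subseteq X$. A theorem is an $a\in A$ with $\emptyset\vdash a$. A deductive relation on a dually integral Abelian pomonoid $\langle R,\leq,+,0\rangle$ (commutative monoid with compatible partial order and least element $0$) is a relation $\vdash$ on $R$ with: $a\leq b\Rightarrow b\vdash a$; transitivity; $a\vdash b\Rightarrow a+c\vdash b+c$. A GTCR on a complete lattice $\mathbf{L}$ is a preorder $\vdash$ on $L$ with $a\geq b\Rightarrow a\vdash b$ and $x\vdash\bigvee\{y:x\vdash y\}$ for all $x$. -}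

module Defs where

open import Data.Product using (Σ; ∃; _×_; _,_)
open import Data.Sum using (_⊎_)
open import Data.List using (List)
open import Data.List.Membership.Propositional using (_∈_)
open import Relation.Nullary using (¬_)
open import Relation.Unary using (Pred; _⊆_; _∪_; ∅) renaming (_∈_ to _∈ₛ_)
open import Level using (0ℓ)

Subset : Set → Set₁
Subset A = Pred A 0ℓ

Finite : {A : Set} → Subset A → Set
Finite {A} P = Σ (List A) λ xs → ∀ {a} → a ∈ₛ P → a ∈ xs

record IsACR {A : Set} (_⊢_ : Subset A → A → Set) : Set₁ where
  field
    reflexive  : ∀ X a → a ∈ₛ X → X ⊢ a
    monotone   : ∀ X Y a → X ⊢ a → X ⊆ Y → Y ⊢ a
    cut        : ∀ X Y a → Y ⊢ a → (∀ b → b ∈ₛ Y → X ⊢ b) → X ⊢ a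

IsFinitary : {A : Set} → (Subset A → A → Set) → Set₁
IsFinitary {A} _⊢_ = ∀ X a → X ⊢ a → Σ (Subset A) λ X₀ → Finite X₀ × X₀ ⊆ X × X₀ ⊢ a

Theorems : {A : Set} → (Subset A → A → Set) → Subset A
Theorems _⊢_ a = ∅ ⊢ a

_⊢'⟨_⟩_ : {A : Set} → Subset A → (Subset A → A → Set) → Subset A → Set
X ⊢'⟨ _⊢_ ⟩ Y = ∀ a → a ∈ₛ Y → X ⊢ a

-- X ⊩ Y  iff  there is a finite Y' ⊆ Y with Y ∖ Y' ⊆ X and X ⊢' Y'.
-- (Y ∖ Y' ⊆ X is rendered as Y ⊆ Y' ∪ X.)
Forces : {A : Set} → (Subset A → A → Set) → Subset A → Subset A → Set₁
Forces {A} _⊢_ X Y =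
  Σ (Subset A) λ Y' → Finite Y' × Y' ⊆ Y × Y ⊆ (Y' ∪ X) × (X ⊢'⟨ _⊢_ ⟩ Y')

record IsDeductive {A : Set} (R : Subset A → Subset A → Set₁) : Set₁ where
  field
    antitone   : ∀ X Y → X ⊆ Y → R Y X
    transitive : ∀ X Y Z → R X Y → R Y Z → R X Z
    compatible : ∀ X Y Z → R X Y → R (X ∪ Z) (Y ∪ Z)

IsJoin : {A : Set} → (Subset A → Set₁) → Subset A → Set₁
IsJoin {A} F J = (∀ Y → F Y → Y ⊆ J) × (∀ U → (∀ Y → F Y → Y ⊆ U) → J ⊆ U)

record IsGTCR {A : Set} (R : Subset A → Subset A → Set₁) : Set₁ where
  field
    refl'      : ∀ X → R X X
    transitive : ∀ X Y Z → R X Y → R Y Z → R X Z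
    antitone   : ∀ X Y → Y ⊆ X → R X Y
    closed     : ∀ X J → IsJoin (λ Y → R X Y) J → R X J

-- Transitivity of ⊩ takes as finite part of Z the elements covered by the finite parts of
-- both steps, and uses cut to pass the consequences of Y on to X. The join of all Y with
-- ∅ ⊩ Y is the set of theorems (each singleton of a theorem is forced by ∅), but ∅ ⊩ Y
-- makes Y itself finite, so the join condition of a GTCR would force the theorems to be
-- finite. Neither half uses finitarity.
module Submission where

open import Defs
open import Data.Product using (_×_; _,_; proj₁; proj₂)
open import Data.Sum using (inj₁; inj₂)
open import Data.List using ([]; _∷_; _++_)
open import Data.List.Relation.Unary.Any using (here)
open import Data.List.Membership.Propositional.Properties using (∈-++⁺ˡ; ∈-++⁺ʳ)
open import Relation.Binary.PropositionalEquality using (refl)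
open import Relation.Nullary using (¬_)
open import Relation.Unary using (_⊆_; _∪_; _∩_; ∅; ｛_｝)

module _ {A : Set} where

  finite-∅ : Finite {A} ∅
  finite-∅ = [] , λ ()

  finite-｛｝ : (a : A) → Finite ｛ a ｝
  finite-｛｝ a = a ∷ [] , λ { refl → here refl }

  finite-∪ : {P Q : Subset A} → Finite P → Finite Q → Finite (P ∪ Q)
  finite-∪ (xs , P⊆xs) (ys , Q⊆ys) = xs ++ ys , λ
    { (inj₁ p) → ∈-++⁺ˡ (P⊆xs p)
    ; (inj₂ q) → ∈-++⁺ʳ xs (Q⊆ys q)
    }

  finite-⊆ : {P Q : Subset A} → P ⊆ Q → Finite Q → Finite P
  finite-⊆ P⊆Q (xs , Q⊆xs) = xs , λ p → Q⊆xs (P⊆Q p)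

module _ {A : Set} {_⊢_ : Subset A → A → Set} where

  private
    _⊩_ : Subset A → Subset A → Set₁
    _⊩_ = Forces _⊢_

  ∅⊩⇒finite : {Y : Subset A} → ∅ ⊩ Y → Finite Y
  ∅⊩⇒finite (Y' , Y'-finite , _ , Y⊆Y'∪∅ , _) =
    finite-⊆ Y⊆Y'∪∅ (finite-∪ Y'-finite finite-∅)

  ∅⊩⇒⊆theorems : {Y : Subset A} → ∅ ⊩ Y → Y ⊆ Theorems _⊢_
  ∅⊩⇒⊆theorems (_ , _ , _ , Y⊆Y'∪∅ , ∅⊢'Y') y with Y⊆Y'∪∅ y
  ... | inj₁ y∈Y' = ∅⊢'Y' _ y∈Y'
  ... | inj₂ ()

  ∅⊩｛theorem｝ : {t : A} → ∅ ⊢ t → ∅ ⊩ ｛ t ｝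
  ∅⊩｛theorem｝ {t} ⊢t = ｛ t ｝ , finite-｛｝ t , (λ p → p) , inj₁ , λ { _ refl → ⊢t }

  theorems-isJoin : IsJoin (∅ ⊩_) (Theorems _⊢_)
  theorems-isJoin = (λ _ → ∅⊩⇒⊆theorems) , λ U bounded ⊢t → bounded _ (∅⊩｛theorem｝ ⊢t) refl

  infinite-theorems⇒¬GTCR : ¬ Finite (Theorems _⊢_) → ¬ IsGTCR (Forces _⊢_)
  infinite-theorems⇒¬GTCR infinite gtcr =
    infinite (∅⊩⇒finite (IsGTCR.closed gtcr ∅ (Theorems _⊢_) theorems-isJoin))

  module _ (acr : IsACR _⊢_) where
    open IsACR acr

    ⊩⇒⊢' : {X Y : Subset A} → X ⊩ Y → X ⊢'⟨ _⊢_ ⟩ Y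
    ⊩⇒⊢' {X} (_ , _ , _ , Y⊆Y'∪X , X⊢'Y') b b∈Y with Y⊆Y'∪X b∈Y
    ... | inj₁ b∈Y' = X⊢'Y' b b∈Y'
    ... | inj₂ b∈X  = reflexive X b b∈X

    ⊩-antitone : ∀ X Y → X ⊆ Y → Y ⊩ X
    ⊩-antitone X Y X⊆Y = ∅ , finite-∅ , (λ ()) , (λ x → inj₂ (X⊆Y x)) , λ _ ()

    ⊩-trans : ∀ X Y Z → X ⊩ Y → Y ⊩ Z → X ⊩ Z
    ⊩-trans X Y Z X⊩Y@(Y' , Y'-finite , _ , Y⊆Y'∪X , X⊢'Y') (Z' , Z'-finite , _ , Z⊆Z'∪Y , Y⊢'Z') =
      Z ∩ (Z' ∪ Y') , finite-⊆ proj₂ (finite-∪ Z'-finite Y'-finite) ,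
      proj₁ , Z⊆Z''∪X , X⊢'Z''
      where
      Z⊆Z''∪X : Z ⊆ ((Z ∩ (Z' ∪ Y')) ∪ X)
      Z⊆Z''∪X z∈Z with Z⊆Z'∪Y z∈Z
      ... | inj₁ z∈Z' = inj₁ (z∈Z , inj₁ z∈Z')
      ... | inj₂ z∈Y with Y⊆Y'∪X z∈Y
      ...   | inj₁ z∈Y' = inj₁ (z∈Z , inj₂ z∈Y')
      ...   | inj₂ z∈X  = inj₂ z∈X

      X⊢'Z'' : X ⊢'⟨ _⊢_ ⟩ (Z ∩ (Z' ∪ Y'))
      X⊢'Z'' a (_ , inj₁ a∈Z') = cut X Y a (Y⊢'Z' a a∈Z') (⊩⇒⊢' X⊩Y)
      X⊢'Z'' a (_ , inj₂ a∈Y') = X⊢'Y' a a∈Y'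

    ⊩-∪-compatible : ∀ X Y Z → X ⊩ Y → (X ∪ Z) ⊩ (Y ∪ Z)
    ⊩-∪-compatible X Y Z (Y' , Y'-finite , Y'⊆Y , Y⊆Y'∪X , X⊢'Y') =
      Y' , Y'-finite , (λ y → inj₁ (Y'⊆Y y)) , Y∪Z⊆Y'∪X∪Z ,
      λ a a∈Y' → monotone X (X ∪ Z) a (X⊢'Y' a a∈Y') inj₁
      where
      Y∪Z⊆Y'∪X∪Z : (Y ∪ Z) ⊆ (Y' ∪ (X ∪ Z))
      Y∪Z⊆Y'∪X∪Z (inj₂ z∈Z) = inj₂ (inj₂ z∈Z)
      Y∪Z⊆Y'∪X∪Z (inj₁ y∈Y) with Y⊆Y'∪X y∈Y
      ... | inj₁ y∈Y' = inj₁ y∈Y'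
      ... | inj₂ y∈X  = inj₂ (inj₁ y∈X)

    ⊩-isDeductive : IsDeductive (Forces _⊢_)
    ⊩-isDeductive = record
      { antitone   = ⊩-antitone
      ; transitive = ⊩-trans
      ; compatible = ⊩-∪-compatible
      }

proposition3p6 : {A : Set} (_⊢_ : Subset A → A → Set) →
    IsACR _⊢_ → IsFinitary _⊢_ → ¬ Finite (Theorems _⊢_) →
    IsDeductive (Forces _⊢_) × ¬ IsGTCR (Forces _⊢_)
proposition3p6 _⊢_ acr _ infinite = ⊩-isDeductive acr , infinite-theorems⇒¬GTCR infinite
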